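{- Let $n\ge1$ and consider the convex polygon $\mathbf{P}_{2n+2}$ with vertices $1,\dots,2n+2$, and for a vertex $i$ let $i'=i+n+1\pmod{2n+2}$. Let $Q_1$ be the set of quadrilaterals of $\mathbf{P}_{2n+2}$ (i.e. $4$-element subsets of vertices) that are contained in a closed $\delta_i$-half-disk for some $i$. Then $|Q_1|=\frac12\left(\binom{2n+2}{4}-\binom{n+1}{2}\right)$.
   Context: A diameter $\delta_i$ of $\mathbf{P}_{2n+2}$ is the arc from vertex $i$ to vertex $i'$. The closures of the two half-disks obtained by cutting $\mathbf{P}_{2n+2}$ along $\delta_i$ are the closed $\delta_i$-half-disks (each contains $i$ and $i'$). A quadrilateral is contained in a closed $\delta_i$-half-disk if all four of its vertices lie in it. -}

module Defs where

open import Data.Bool using (Bool; true; false)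
open import Data.Nat using (ℕ; zero; suc; _+_; _*_; _∸_; _≤_)
open import Data.Nat.DivMod using (_%_; _mod_)
open import Data.Nat.Properties using (_≤?_)
open import Data.Fin using (Fin; toℕ)
open import Data.Fin.Properties using (any?)
open import Data.Fin.Subset using (Subset; _⊆_; ∣_∣)
open import Data.Fin.Subset.Properties using (_⊆?_)
open import Data.Vec using (Vec; []; _∷_; tabulate)
open import Data.List using (List; []; _∷_; map; _++_; filter; length)
open import Data.Product using (∃; _×_)
open import Data.Sum using (_⊎_)
open import Relation.Binary.PropositionalEquality using (_≡_)
open import Relation.Nullary using (Dec; does; _×-dec_; _⊎-dec_)
import Data.Nat.Properties as ℕP

-- Vertices of P_{2n+2} are Fin (2n+2) in cyclic order; the paper's vertex k
-- corresponds to the element k-1 (vertex 2n+2 to 2n+1).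
N : ℕ → ℕ
N n = 2 + 2 * n

antipode : (n : ℕ) → Fin (N n) → Fin (N n)
antipode n i = (toℕ i + (n + 1)) mod N n

fwd : (n : ℕ) → Fin (N n) → Fin (N n) → ℕ
fwd n a b = ((toℕ b + N n) ∸ toℕ a) % N n

arc : (n : ℕ) → Fin (N n) → Fin (N n) → Subset (N n)
arc n a b = tabulate λ j → does (fwd n a j ≤? fwd n a b)

-- Cutting P_{2n+2} along the diameter δ_i (from i to i') gives two closed
-- half-disks; their vertex sets are the arcs i → i' and i' → i.
InHalfDisk : (n : ℕ) → Fin (N n) → Subset (N n) → Set
InHalfDisk n i S = S ⊆ arc n i (antipode n i) ⊎ S ⊆ arc n (antipode n i) i

InQ₁ : (n : ℕ) → Subset (N n) → Set
InQ₁ n S = (∣ S ∣ ≡ 4) × ∃ λ i → InHalfDisk n i S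

InQ₁? : (n : ℕ) → (S : Subset (N n)) → Dec (InQ₁ n S)
InQ₁? n S = (∣ S ∣ ℕP.≟ 4) ×-dec any? (λ i → (S ⊆? arc n i (antipode n i)) ⊎-dec (S ⊆? arc n (antipode n i) i))

allSubsets : (m : ℕ) → List (Subset m)
allSubsets zero = [] ∷ []
allSubsets (suc m) = map (true ∷_) (allSubsets m) ++ map (false ∷_) (allSubsets m)

cardQ₁ : ℕ → ℕ
cardQ₁ n = length (filter (InQ₁? n) (allSubsets (N n)))

-- Call a ∈ S a leader of the quadrilateral S if S lies in the closed half-disk
-- running n + 1 steps forward from a.  Every quadrilateral of Q₁ has exactly one
-- leader: the first vertex of S along a half-disk containing S is one, and two
-- distinct leaders would be antipodal and leave no room for a third vertex.
-- With the leader a fixed, the remaining three vertices are any 3 of the n + 1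
-- vertices following a, so |Q₁| = (2n+2)·C(n+1,3); the stated identity is then
-- a polynomial identity once each C(m,k) is written as a falling factorial over k!.
module Submission where

open import Data.Bool using (Bool; true; false; T; _∧_; if_then_else_)
open import Data.Bool.Properties using (∧-zeroʳ; T-∧; T-≡)
open import Data.Empty using (⊥-elim)
open import Data.Fin using (Fin; zero; suc; toℕ; fromℕ<; punchIn) renaming (_≟_ to _≟ᶠ_)
open import Data.Fin.Permutation using (Permutation; permutation)
open import Data.Fin.Properties using (toℕ<n; toℕ-injective; toℕ-fromℕ<; punchInᵢ≢i; any?)
open import Data.Fin.Subset using (Subset; ∣_∣; _∈_; _⊆_; ⁅_⁆; _∪_; Nonempty)
open import Data.Fin.Subset.Properties
  using (_∈?_; _⊆?_; nonempty?; Empty-unique; ∣⊥∣≡0; p⊆q⇒∣p∣≤∣q∣; x∈p∪q⁺; x∈⁅x⁆; ∣⁅x⁆∣≡1)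
open import Data.List using (List; []; _∷_; map; _++_; filter; length)
open import Data.List.Properties using (map-++; map-∘; map-cong)
open import Data.Maybe using (Maybe; just; nothing)
open import Data.Nat
open import Data.Nat.Combinatorics using (_C_; nC1≡n; nCk+nC[k+1]≡[n+1]C[k+1])
open import Data.Nat.DivMod
import Data.Nat.ListAction as List
open import Data.Nat.ListAction.Properties using (sum-++)
open import Data.Nat.Properties
open import Algebra.Properties.CommutativeMonoid.Sum +-0-commutativeMonoid
  using (sum; sum-syntax; sum-cong-≗; sum-replicate-zero; sum-remove; ∑-distrib-+; ∑-permute)
open import Data.Nat.Tactic.RingSolver using (solve-∀)
open import Data.Product using (Σ; ∃; _×_; _,_; proj₁; proj₂)
open import Data.Sum using (inj₁; inj₂)
open import Data.Vec using ([]; _∷_; lookup; tabulate)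
open import Data.Vec.Functional using (Vector)
open import Data.Vec.Properties using (lookup∘tabulate; []=⇒lookup; lookup⇒[]=)
open import Function using (_∘_; _⇔_; mk⇔; Equivalence)
open import Relation.Binary.PropositionalEquality
open import Relation.Nullary using (Dec; does; yes; no; ¬_; _×-dec_; contradiction)
open import Relation.Nullary.Decidable using (dec-true; dec-false; does-⇔; T?)
open import Relation.Unary using (Decidable)

open import Defs

private variable
  X Y : Set

-- Falling factorials and binomial coefficients

falling : ℕ → ℕ → ℕ
falling n zero    = 1
falling n (suc k) = n * falling (pred n) k

[k+1]*[n+1]C[k+1]≡[n+1]*nCk : ∀ n k → suc k * (suc n C suc k) ≡ suc n * (n C k)
[k+1]*[n+1]C[k+1]≡[n+1]*nCk zero    zero    = refl
[k+1]*[n+1]C[k+1]≡[n+1]*nCk zero    (suc k) = *-zeroʳ (suc (suc k))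
[k+1]*[n+1]C[k+1]≡[n+1]*nCk (suc n) zero    = begin
  1 * (suc (suc n) C 1) ≡⟨ *-identityˡ _ ⟩
  suc (suc n) C 1       ≡⟨ nC1≡n (suc (suc n)) ⟩
  suc (suc n)           ≡⟨ *-identityʳ (suc (suc n)) ⟨
  suc (suc n) * 1       ∎
  where open ≡-Reasoning
[k+1]*[n+1]C[k+1]≡[n+1]*nCk (suc n) (suc k) = begin
  suc (suc k) * (suc (suc n) C suc (suc k))  ≡⟨ cong (suc (suc k) *_) (pascal (suc n) (suc k)) ⟨
  suc (suc k) * (a + b)                      ≡⟨ regroup₁ k a b ⟩
  suc k * a + a + suc (suc k) * b            ≡⟨ cong₂ (λ u v → u + a + v) (absorb n k) (absorb n (suc k)) ⟩
  suc n * x + a + suc n * y                  ≡⟨ regroup₂ n x y a ⟩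
  suc n * (x + y) + a                        ≡⟨ cong (λ z → suc n * z + a) (pascal n k) ⟩
  suc n * a + a                              ≡⟨ +-comm (suc n * a) a ⟩
  suc (suc n) * a                            ∎
  where
  open ≡-Reasoning
  pascal = nCk+nC[k+1]≡[n+1]C[k+1]
  absorb = [k+1]*[n+1]C[k+1]≡[n+1]*nCk
  a = suc n C suc k
  b = suc n C suc (suc k)
  x = n C k
  y = n C suc k
  regroup₁ : ∀ k a b → suc (suc k) * (a + b) ≡ suc k * a + a + suc (suc k) * b
  regroup₁ = solve-∀
  regroup₂ : ∀ n x y a → suc n * x + a + suc n * y ≡ suc n * (x + y) + a
  regroup₂ = solve-∀

k!*nCk≡falling : ∀ n k → k ! * (n C k) ≡ falling n k
k!*nCk≡falling n       zero    = refl
k!*nCk≡falling zero    (suc k) = *-zeroʳ (suc k !)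
k!*nCk≡falling (suc n) (suc k) = begin
  suc k * k ! * (suc n C suc k)   ≡⟨ *-assoc (suc k) (k !) _ ⟩
  suc k * (k ! * (suc n C suc k)) ≡⟨ x*[y*z]≡y*[x*z] (suc k) (k !) _ ⟩
  k ! * (suc k * (suc n C suc k)) ≡⟨ cong (k ! *_) ([k+1]*[n+1]C[k+1]≡[n+1]*nCk n k) ⟩
  k ! * (suc n * (n C k))         ≡⟨ x*[y*z]≡y*[x*z] (k !) (suc n) _ ⟩
  suc n * (k ! * (n C k))         ≡⟨ cong (suc n *_) (k!*nCk≡falling n k) ⟩
  suc n * falling n k             ∎
  where
  open ≡-Reasoning
  x*[y*z]≡y*[x*z] : ∀ x y z → x * (y * z) ≡ y * (x * z)
  x*[y*z]≡y*[x*z] = solve-∀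

2*[[2n+2]*[n+1]C3]+[n+1]C2≡[2n+2]C4 : ∀ {n} → n ≥ 1 →
  2 * ((2 * n + 2) * ((n + 1) C 3)) + (n + 1) C 2 ≡ (2 * n + 2) C 4
2*[[2n+2]*[n+1]C3]+[n+1]C2≡[2n+2]C4 {n@(suc k)} _ = *-cancelˡ-≡ _ _ (4 !) (begin
  4 ! * (2 * ((2 * n + 2) * ((n + 1) C 3)) + (n + 1) C 2)
    ≡⟨ cong₂ (λ m p → 4 ! * (2 * (m * (p C 3)) + p C 2)) m≡ p≡ ⟩
  4 ! * (2 * (m * (p C 3)) + p C 2)
    ≡⟨ regroup m (p C 3) (p C 2) ⟩
  8 * m * (3 ! * (p C 3)) + 12 * (2 ! * (p C 2))
    ≡⟨ cong₂ (λ x y → 8 * m * x + 12 * y) (k!*nCk≡falling p 3) (k!*nCk≡falling p 2) ⟩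
  8 * m * falling p 3 + 12 * falling p 2
    ≡⟨ polynomial k ⟩
  falling m 4
    ≡⟨ k!*nCk≡falling m 4 ⟨
  4 ! * (m C 4)
    ≡⟨ cong (λ m → 4 ! * (m C 4)) m≡ ⟨
  4 ! * ((2 * n + 2) C 4) ∎)
  where
  open ≡-Reasoning
  -- In these successor forms every falling factorial unfolds to a product of linear terms in k.
  m = suc (suc (suc (suc (k + k))))
  p = suc (suc k)
  m≡ : 2 * n + 2 ≡ m
  m≡ = 2[k+1]+2≡4+[k+k] k
    where 2[k+1]+2≡4+[k+k] : ∀ k → 2 * suc k + 2 ≡ suc (suc (suc (suc (k + k))))
          2[k+1]+2≡4+[k+k] = solve-∀
  p≡ : n + 1 ≡ p
  p≡ = +-comm n 1
  regroup : ∀ m x y → 24 * (2 * (m * x) + y) ≡ 8 * m * (6 * x) + 12 * (2 * y)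
  regroup = solve-∀
  polynomial : ∀ k →
    8 * (4 + (k + k)) * ((2 + k) * ((1 + k) * (k * 1))) + 12 * ((2 + k) * ((1 + k) * 1))
      ≡ (4 + (k + k)) * ((3 + (k + k)) * ((2 + (k + k)) * ((1 + (k + k)) * 1)))
  polynomial = solve-∀

𝟙 : Bool → ℕ
𝟙 true  = 1
𝟙 false = 0

count : (X → Bool) → List X → ℕ
count p xs = List.sum (map (𝟙 ∘ p) xs)

length-filter≡count : ∀ {P : X → Set} (P? : Decidable P) xs → length (filter P? xs) ≡ count (does ∘ P?) xs
length-filter≡count P? [] = refl
length-filter≡count P? (x ∷ xs) with does (P? x)
... | true  = cong suc (length-filter≡count P? xs)
... | false = length-filter≡count P? xs

count-++ : ∀ (p : X → Bool) xs ys → count p (xs ++ ys) ≡ count p xs + count p ys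
count-++ p xs ys = trans (cong List.sum (map-++ (𝟙 ∘ p) xs ys)) (sum-++ (map (𝟙 ∘ p) xs) _)

count-map : ∀ (p : Y → Bool) (f : X → Y) xs → count p (map f xs) ≡ count (p ∘ f) xs
count-map p f xs = cong List.sum (sym (map-∘ xs))

count-cong : ∀ {p q : X → Bool} → (∀ x → p x ≡ q x) → ∀ xs → count p xs ≡ count q xs
count-cong p≗q xs = cong List.sum (map-cong (cong 𝟙 ∘ p≗q) xs)

count-false : ∀ (xs : List X) → count (λ _ → false) xs ≡ 0
count-false []       = refl
count-false (_ ∷ xs) = count-false xs

count-∑ : ∀ {m} (p : X → Bool) (q : Fin m → X → Bool) →
          (∀ x → 𝟙 (p x) ≡ ∑[ a < m ] 𝟙 (q a x)) →
          ∀ xs → count p xs ≡ ∑[ a < m ] count (q a) xs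
count-∑ {m = m} p q split []       = sym (sum-replicate-zero m)
count-∑ p q split (x ∷ xs) = begin
  𝟙 (p x) + count p xs                               ≡⟨ cong₂ _+_ (split x) (count-∑ p q split xs) ⟩
  ∑[ a < _ ] 𝟙 (q a x) + ∑[ a < _ ] count (q a) xs   ≡⟨ ∑-distrib-+ (λ a → 𝟙 (q a x)) (λ a → count (q a) xs) ⟨
  ∑[ a < _ ] (𝟙 (q a x) + count (q a) xs)            ∎
  where open ≡-Reasoning

∑-const : ∀ m c → ∑[ _ < m ] c ≡ m * c
∑-const zero    c = refl
∑-const (suc m) c = cong (c +_) (∑-const m c)

∑-𝟙-<ᵇ : ∀ {m c} → c ≤ m → ∑[ k < m ] 𝟙 (toℕ k <ᵇ c) ≡ c
∑-𝟙-<ᵇ {zero}  z≤n     = refl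
∑-𝟙-<ᵇ {suc m} {zero}  _ = sum-replicate-zero m
∑-𝟙-<ᵇ {suc m} {suc c} (s≤s c≤m) = cong suc (∑-𝟙-<ᵇ c≤m)

∑-𝟙-none : ∀ {m} {P : Fin m → Set} (P? : ∀ a → Dec (P a)) → (∀ a → ¬ P a) → ∑[ a < m ] 𝟙 (does (P? a)) ≡ 0
∑-𝟙-none {m} P? ¬P = trans (sum-cong-≗ (λ a → cong 𝟙 (dec-false (P? a) (¬P a)))) (sum-replicate-zero m)

∑-𝟙-unique : ∀ {m} {P : Fin m → Set} (P? : ∀ a → Dec (P a)) {a} → P a → (∀ {b} → P b → b ≡ a) →
             ∑[ b < m ] 𝟙 (does (P? b)) ≡ 1
∑-𝟙-unique {suc m} P? {a} Pa unique = trans (sum-remove {i = a} (𝟙 ∘ does ∘ P?))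
  (cong₂ _+_ (cong 𝟙 (dec-true (P? a) Pa)) (∑-𝟙-none (P? ∘ punchIn a) (λ b → punchInᵢ≢i a b ∘ unique)))

∈⇒T-lookup : ∀ {m} {S : Subset m} {j} → j ∈ S → T (lookup S j)
∈⇒T-lookup j∈ = Equivalence.from T-≡ ([]=⇒lookup j∈)

T-lookup⇒∈ : ∀ {m} {S : Subset m} {j} → T (lookup S j) → j ∈ S
T-lookup⇒∈ {S = S} {j} t = lookup⇒[]= j S (Equivalence.to T-≡ t)

∣p∪q∣≤∣p∣+∣q∣ : ∀ {m} (p q : Subset m) → ∣ p ∪ q ∣ ≤ ∣ p ∣ + ∣ q ∣
∣p∪q∣≤∣p∣+∣q∣ []          []          = z≤n
∣p∪q∣≤∣p∣+∣q∣ (true ∷ p)  (true ∷ q)  = s≤s (≤-trans (∣p∪q∣≤∣p∣+∣q∣ p q) (≤-trans (n≤1+n _) (≤-reflexive (sym (+-suc _ _)))))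
∣p∪q∣≤∣p∣+∣q∣ (true ∷ p)  (false ∷ q) = s≤s (∣p∪q∣≤∣p∣+∣q∣ p q)
∣p∪q∣≤∣p∣+∣q∣ (false ∷ p) (true ∷ q)  = ≤-trans (s≤s (∣p∪q∣≤∣p∣+∣q∣ p q)) (≤-reflexive (sym (+-suc _ _)))
∣p∪q∣≤∣p∣+∣q∣ (false ∷ p) (false ∷ q) = ∣p∪q∣≤∣p∣+∣q∣ p q

∣p∣≡suc⇒Nonempty : ∀ {m k} (p : Subset m) → ∣ p ∣ ≡ suc k → Nonempty p
∣p∣≡suc⇒Nonempty {m} p eq with nonempty? p
... | yes ne = ne
... | no ¬ne = contradiction (trans (sym eq) (trans (cong ∣_∣ (Empty-unique ¬ne)) (∣⊥∣≡0 m))) (λ ())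

argmin : ∀ {m} (f : Fin m → ℕ) (p : Subset m) → Nonempty p → Σ (Fin m) λ a → a ∈ p × (∀ {y} → y ∈ p → f a ≤ f y)
argmin {m} f p (x , x∈p) = search (f x) x x∈p ≤-refl
  where
  search : ∀ k x → x ∈ p → f x ≤ k → Σ (Fin m) λ a → a ∈ p × (∀ {y} → y ∈ p → f a ≤ f y)
  search zero    x x∈p fx≤0 = x , x∈p , λ _ → ≤-trans fx≤0 z≤n
  search (suc k) x x∈p fx≤k with any? (λ y → (y ∈? p) ×-dec (f y ≤? k))
  ... | yes (y , y∈p , fy≤k) = search k y y∈p fy≤k
  ... | no  none             = x , x∈p , λ {y} y∈p → ≤-trans fx≤k (≰⇒> (λ fy≤k → none (y , y∈p , fy≤k)))

∈-tabulate⁻ : ∀ {m} {f : Fin m → Bool} {j} → j ∈ tabulate f → T (f j)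
∈-tabulate⁻ {f = f} {j} j∈ = subst T (lookup∘tabulate f j) (∈⇒T-lookup j∈)

∈-tabulate⁺ : ∀ {m} {f : Fin m → Bool} {j} → T (f j) → j ∈ tabulate f
∈-tabulate⁺ {f = f} {j} fj = T-lookup⇒∈ (subst T (sym (lookup∘tabulate f j)) fj)

-- At each position, just true forces membership, just false forbids it, and nothing leaves it free.
Pattern : ℕ → Set
Pattern m = Vector (Maybe Bool) m

admits : Maybe Bool → Bool → Bool
admits nothing      _     = true
admits (just true)  b     = b
admits (just false) true  = false
admits (just false) false = true

isFree : Maybe Bool → ℕ
isFree nothing  = 1
isFree (just _) = 0

isForced : Maybe Bool → ℕ
isForced (just true) = 1
isForced _           = 0

free : ∀ {m} → Pattern m → ℕ
free {m} P = ∑[ j < m ] isFree (P j)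

forced : ∀ {m} → Pattern m → ℕ
forced {m} P = ∑[ j < m ] isForced (P j)

fits : ∀ {m} → Pattern m → Subset m → Bool
fits P []      = true
fits P (b ∷ S) = admits (P zero) b ∧ fits (P ∘ suc) S

isFreeMember : Maybe Bool → Bool → ℕ
isFreeMember c true  = isFree c
isFreeMember c false = 0

freeMembers : ∀ {m} → Pattern m → Subset m → ℕ
freeMembers P []      = 0
freeMembers P (b ∷ S) = isFreeMember (P zero) b + freeMembers (P ∘ suc) S

count-fits : ∀ {m} (P : Pattern m) k →
  count (λ S → fits P S ∧ (freeMembers P S ≡ᵇ k)) (allSubsets m) ≡ free P C k
count-fits {zero}  P zero    = refl
count-fits {zero}  P (suc k) = refl
count-fits {suc m} P k = begin
  count fitsₖ (map (true ∷_) A ++ map (false ∷_) A)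
    ≡⟨ count-++ fitsₖ (map (true ∷_) A) _ ⟩
  count fitsₖ (map (true ∷_) A) + count fitsₖ (map (false ∷_) A)
    ≡⟨ cong₂ _+_ (count-map fitsₖ (true ∷_) A) (count-map fitsₖ (false ∷_) A) ⟩
  count (fitsₖ ∘ (true ∷_)) A + count (fitsₖ ∘ (false ∷_)) A
    ≡⟨ by-head (P zero) (P ∘ suc) k ⟩
  free P C k ∎
  where
  open ≡-Reasoning
  A = allSubsets m
  fitsₖ = λ S → fits P S ∧ (freeMembers P S ≡ᵇ k)
  with-head : Maybe Bool → Pattern m → ℕ → Bool → Subset m → Bool
  with-head c Q k b S = (admits c b ∧ fits Q S) ∧ (isFreeMember c b + freeMembers Q S ≡ᵇ k)
  by-head : ∀ c Q k → count (with-head c Q k true) A + count (with-head c Q k false) A ≡ (isFree c + free Q) C k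
  by-head (just true)  Q k = trans (cong₂ _+_ (count-fits Q k) (count-false A)) (+-identityʳ _)
  by-head (just false) Q k = cong₂ _+_ (count-false A) (count-fits Q k)
  by-head nothing Q zero = cong₂ _+_
    (trans (count-cong (λ S → ∧-zeroʳ (fits Q S)) A) (count-false A)) (count-fits Q zero)
  by-head nothing Q (suc k) = trans (cong₂ _+_ (count-fits Q k) (count-fits Q (suc k)))
    (nCk+nC[k+1]≡[n+1]C[k+1] (free Q) k)

∣∣≡freeMembers+forced : ∀ {m} (P : Pattern m) S → T (fits P S) → ∣ S ∣ ≡ freeMembers P S + forced P
∣∣≡freeMembers+forced P []      _  = refl
∣∣≡freeMembers+forced P (b ∷ S) ok = by-head (P zero) b ok
  where
  by-head : ∀ c b → T (admits c b ∧ fits (P ∘ suc) S) →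
            ∣ b ∷ S ∣ ≡ isFreeMember c b + freeMembers (P ∘ suc) S + (isForced c + forced (P ∘ suc))
  by-head nothing      true  ok = cong suc (∣∣≡freeMembers+forced (P ∘ suc) S ok)
  by-head nothing      false ok = ∣∣≡freeMembers+forced (P ∘ suc) S ok
  by-head (just true)  true  ok = trans (cong suc (∣∣≡freeMembers+forced (P ∘ suc) S ok)) (sym (+-suc _ _))
  by-head (just false) false ok = ∣∣≡freeMembers+forced (P ∘ suc) S ok

fits⇒admits : ∀ {m} (P : Pattern m) S → T (fits P S) → ∀ j → T (admits (P j) (lookup S j))
fits⇒admits P (b ∷ S) ok zero    = proj₁ (Equivalence.to T-∧ ok)
fits⇒admits P (b ∷ S) ok (suc j) = fits⇒admits (P ∘ suc) S (proj₂ (Equivalence.to T-∧ ok)) j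

admits⇒fits : ∀ {m} (P : Pattern m) S → (∀ j → T (admits (P j) (lookup S j))) → T (fits P S)
admits⇒fits P []      _  = _
admits⇒fits P (b ∷ S) ok = Equivalence.from T-∧ (ok zero , admits⇒fits (P ∘ suc) S (ok ∘ suc))

-- Cyclic distance

module CyclicDistance (d : ℕ) .{{_ : NonZero d}} where

  [m%d+n]%d≡[m+n]%d : ∀ m n → (m % d + n) % d ≡ (m + n) % d
  [m%d+n]%d≡[m+n]%d m n = begin
    (m % d + n) % d           ≡⟨ %-distribˡ-+ (m % d) n d ⟩
    (m % d % d + n % d) % d   ≡⟨ cong (λ z → (z + n % d) % d) (m%n%n≡m%n m d) ⟩
    (m % d + n % d) % d       ≡⟨ %-distribˡ-+ m n d ⟨
    (m + n) % d               ∎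
    where open ≡-Reasoning

  %-cancelʳ-+ : ∀ {x} u v → x ≤ d → (u + x) % d ≡ (v + x) % d → u % d ≡ v % d
  %-cancelʳ-+ {x} u v x≤d eq = begin
    u % d                          ≡⟨ complete u ⟩
    ((u + x) % d + (d ∸ x)) % d    ≡⟨ cong (λ z → (z + (d ∸ x)) % d) eq ⟩
    ((v + x) % d + (d ∸ x)) % d    ≡⟨ complete v ⟨
    v % d                          ∎
    where
    open ≡-Reasoning
    complete : ∀ u → u % d ≡ ((u + x) % d + (d ∸ x)) % d
    complete u = begin
      u % d                      ≡⟨ [m+n]%n≡m%n u d ⟨
      (u + d) % d                ≡⟨ cong (λ z → (u + z) % d) (m+[n∸m]≡n x≤d) ⟨
      (u + (x + (d ∸ x))) % d    ≡⟨ cong (_% d) (+-assoc u x (d ∸ x)) ⟨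
      (u + x + (d ∸ x)) % d      ≡⟨ [m%d+n]%d≡[m+n]%d (u + x) (d ∸ x) ⟨
      ((u + x) % d + (d ∸ x)) % d ∎

  infixl 6 _⊕_

  _⊕_ : Fin d → ℕ → Fin d
  x ⊕ k = (toℕ x + k) mod d

  -- The forward distance (y - x) mod d; for d = N n this is fwd n by definition.
  δ : Fin d → Fin d → ℕ
  δ x y = ((toℕ y + d) ∸ toℕ x) % d

  toℕ-⊕ : ∀ x k → toℕ (x ⊕ k) ≡ (toℕ x + k) % d
  toℕ-⊕ x k = toℕ-fromℕ< (m%n<n (toℕ x + k) d)

  δ<d : ∀ x y → δ x y < d
  δ<d x y = m%n<n _ d

  ⊕-assoc : ∀ x k l → x ⊕ k ⊕ l ≡ x ⊕ (k + l)
  ⊕-assoc x k l = toℕ-injective (begin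
    toℕ (x ⊕ k ⊕ l)              ≡⟨ toℕ-⊕ (x ⊕ k) l ⟩
    (toℕ (x ⊕ k) + l) % d         ≡⟨ cong (λ z → (z + l) % d) (toℕ-⊕ x k) ⟩
    ((toℕ x + k) % d + l) % d     ≡⟨ [m%d+n]%d≡[m+n]%d (toℕ x + k) l ⟩
    (toℕ x + k + l) % d           ≡⟨ cong (_% d) (+-assoc (toℕ x) k l) ⟩
    (toℕ x + (k + l)) % d         ≡⟨ toℕ-⊕ x (k + l) ⟨
    toℕ (x ⊕ (k + l))            ∎)
    where open ≡-Reasoning

  ⊕-identityʳ : ∀ x → x ⊕ 0 ≡ x
  ⊕-identityʳ x = toℕ-injective (begin
    toℕ (x ⊕ 0)          ≡⟨ toℕ-⊕ x 0 ⟩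
    (toℕ x + 0) % d      ≡⟨ cong (_% d) (+-identityʳ (toℕ x)) ⟩
    toℕ x % d            ≡⟨ m<n⇒m%n≡m (toℕ<n x) ⟩
    toℕ x                ∎)
    where open ≡-Reasoning

  ⊕-period : ∀ x → x ⊕ d ≡ x
  ⊕-period x = toℕ-injective (begin
    toℕ (x ⊕ d)          ≡⟨ toℕ-⊕ x d ⟩
    (toℕ x + d) % d      ≡⟨ [m+n]%n≡m%n (toℕ x) d ⟩
    toℕ x % d            ≡⟨ m<n⇒m%n≡m (toℕ<n x) ⟩
    toℕ x                ∎)
    where open ≡-Reasoning

  δ-⊕ : ∀ x {k} → k < d → δ x (x ⊕ k) ≡ k
  δ-⊕ x {k} k<d = begin
    δ x (x ⊕ k)        ≡⟨ %-cancelʳ-+ t k (<⇒≤ (toℕ<n x)) (begin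
      (t + toℕ x) % d      ≡⟨ cong (_% d) (m∸n+n≡m (≤-trans (<⇒≤ (toℕ<n x)) (m≤n+m d w))) ⟩
      (w + d) % d          ≡⟨ [m+n]%n≡m%n w d ⟩
      w % d                ≡⟨ cong (_% d) (toℕ-⊕ x k) ⟩
      (toℕ x + k) % d % d  ≡⟨ m%n%n≡m%n (toℕ x + k) d ⟩
      (toℕ x + k) % d      ≡⟨ cong (_% d) (+-comm (toℕ x) k) ⟩
      (k + toℕ x) % d      ∎) ⟩
    k % d              ≡⟨ m<n⇒m%n≡m k<d ⟩
    k                  ∎
    where
    open ≡-Reasoning
    w = toℕ (x ⊕ k)
    t = (w + d) ∸ toℕ x

  ⊕-δ : ∀ x y → x ⊕ δ x y ≡ y
  ⊕-δ x y = toℕ-injective (begin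
    toℕ (x ⊕ δ x y)                               ≡⟨ toℕ-⊕ x (δ x y) ⟩
    (toℕ x + ((toℕ y + d) ∸ toℕ x) % d) % d        ≡⟨ cong (_% d) (+-comm (toℕ x) _) ⟩
    (((toℕ y + d) ∸ toℕ x) % d + toℕ x) % d        ≡⟨ [m%d+n]%d≡[m+n]%d _ (toℕ x) ⟩
    ((toℕ y + d) ∸ toℕ x + toℕ x) % d              ≡⟨ cong (_% d) (m∸n+n≡m (≤-trans (<⇒≤ (toℕ<n x)) (m≤n+m d (toℕ y)))) ⟩
    (toℕ y + d) % d                               ≡⟨ [m+n]%n≡m%n (toℕ y) d ⟩
    toℕ y % d                                     ≡⟨ m<n⇒m%n≡m (toℕ<n y) ⟩
    toℕ y                                         ∎)
    where open ≡-Reasoning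

  δ-refl : ∀ x → δ x x ≡ 0
  δ-refl x = trans (cong (_% d) (m+n∸m≡n (toℕ x) d)) (n%n≡0 d)

  δ≡0⇒≡ : ∀ {x y} → δ x y ≡ 0 → y ≡ x
  δ≡0⇒≡ {x} {y} eq = begin
    y              ≡⟨ ⊕-δ x y ⟨
    x ⊕ δ x y      ≡⟨ cong (x ⊕_) eq ⟩
    x ⊕ 0          ≡⟨ ⊕-identityʳ x ⟩
    x              ∎
    where open ≡-Reasoning

  δ-trans : ∀ j a s → δ j a ≤ δ j s → δ a s + δ j a ≡ δ j s
  δ-trans j a s p≤q = trans (cong (_+ δ j a) δas≡q∸p) (m∸n+n≡m p≤q)
    where
    open ≡-Reasoning
    p = δ j a
    q = δ j s
    s≡a⊕[q∸p] : s ≡ a ⊕ (q ∸ p)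
    s≡a⊕[q∸p] = begin
      s                  ≡⟨ ⊕-δ j s ⟨
      j ⊕ q              ≡⟨ cong (j ⊕_) (m+[n∸m]≡n p≤q) ⟨
      j ⊕ (p + (q ∸ p))  ≡⟨ ⊕-assoc j p (q ∸ p) ⟨
      j ⊕ p ⊕ (q ∸ p)    ≡⟨ cong (_⊕ (q ∸ p)) (⊕-δ j a) ⟩
      a ⊕ (q ∸ p)        ∎
    δas≡q∸p : δ a s ≡ q ∸ p
    δas≡q∸p = trans (cong (δ a) s≡a⊕[q∸p]) (δ-⊕ a (≤-<-trans (m∸n≤m q p) (δ<d j s)))

  δ-sym : ∀ {a b} → b ≢ a → δ a b + δ b a ≡ d
  δ-sym {a} {b} b≢a = trans (cong (p +_) δba≡d∸p) (m+[n∸m]≡n (<⇒≤ (δ<d a b)))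
    where
    open ≡-Reasoning
    p = δ a b
    p≢0 : p ≢ 0
    p≢0 = b≢a ∘ δ≡0⇒≡
    a≡b⊕[d∸p] : a ≡ b ⊕ (d ∸ p)
    a≡b⊕[d∸p] = begin
      a                  ≡⟨ ⊕-period a ⟨
      a ⊕ d              ≡⟨ cong (a ⊕_) (m+[n∸m]≡n (<⇒≤ (δ<d a b))) ⟨
      a ⊕ (p + (d ∸ p))  ≡⟨ ⊕-assoc a p (d ∸ p) ⟨
      a ⊕ p ⊕ (d ∸ p)    ≡⟨ cong (_⊕ (d ∸ p)) (⊕-δ a b) ⟩
      b ⊕ (d ∸ p)        ∎
    δba≡d∸p : δ b a ≡ d ∸ p
    δba≡d∸p = trans (cong (δ b) a≡b⊕[d∸p]) (δ-⊕ b (∸-monoʳ-< (n≢0⇒n>0 p≢0) (<⇒≤ (δ<d a b))))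

  rotation : Fin d → Permutation d d
  rotation x = permutation (λ k → x ⊕ toℕ k) (λ y → fromℕ< (δ<d x y))
    (λ y → trans (cong (x ⊕_) (toℕ-fromℕ< (δ<d x y))) (⊕-δ x y))
    (λ k → toℕ-injective (trans (toℕ-fromℕ< (δ<d x (x ⊕ toℕ k))) (δ-⊕ x (toℕ<n k))))

  ∑-δ : ∀ x (g : ℕ → ℕ) → ∑[ j < d ] g (δ x j) ≡ ∑[ k < d ] g (toℕ k)
  ∑-δ x g = trans (∑-permute (λ j → g (δ x j)) (rotation x)) (sum-cong-≗ (λ k → cong g (δ-⊕ x (toℕ<n k))))

-- The polygon P_{2n+2}

module Polygon (n : ℕ) where

  open CyclicDistance (N n)

  private
    d = N n
    L = allSubsets d

  d≡[n+1]+[n+1] : d ≡ n + 1 + (n + 1)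
  d≡[n+1]+[n+1] = lemma n
    where lemma : ∀ n → 2 + 2 * n ≡ n + 1 + (n + 1)
          lemma = solve-∀

  n+1≤1+2n : n + 1 ≤ suc (2 * n)
  n+1≤1+2n = ≤-trans (≤-reflexive (+-comm n 1)) (s≤s (m≤m+n n (n + 0)))

  -- does (m ≤? n) computes to m ≤ᵇ n, which lets the tabulated arc be read back.
  ∈-arc⁻ : ∀ a b {j} → j ∈ arc n a b → fwd n a j ≤ fwd n a b
  ∈-arc⁻ a b {j} j∈ = ≤ᵇ⇒≤ (fwd n a j) (fwd n a b) (∈-tabulate⁻ {f = λ j → fwd n a j ≤ᵇ fwd n a b} j∈)

  ∈-arc⁺ : ∀ a b {j} → fwd n a j ≤ fwd n a b → j ∈ arc n a b
  ∈-arc⁺ a b {j} le = ∈-tabulate⁺ {f = λ j → fwd n a j ≤ᵇ fwd n a b} (≤⇒≤ᵇ le)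

  fwd-antipode : ∀ i → fwd n i (antipode n i) ≡ n + 1
  fwd-antipode i = δ-⊕ i (s≤s n+1≤1+2n)

  fwd-antipode⁻¹ : ∀ i → fwd n (antipode n i) i ≡ n + 1
  fwd-antipode⁻¹ i = +-cancelʳ-≡ (n + 1) _ _ (begin
    fwd n i' i + (n + 1)            ≡⟨ cong (fwd n i' i +_) (fwd-antipode i) ⟨
    fwd n i' i + fwd n i i'         ≡⟨ δ-sym i≢i' ⟩
    d                               ≡⟨ d≡[n+1]+[n+1] ⟩
    n + 1 + (n + 1)                 ∎)
    where
    open ≡-Reasoning
    i' = antipode n i
    i≢i' : i ≢ i'
    i≢i' i≡i' = m+1+n≢0 n (trans (sym (fwd-antipode i)) (trans (cong (fwd n i) (sym i≡i')) (δ-refl i)))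

  halfDisk : Fin d → Subset d
  halfDisk a = arc n a (antipode n a)

  ∈-halfDisk⁻ : ∀ a {j} → j ∈ halfDisk a → fwd n a j ≤ n + 1
  ∈-halfDisk⁻ a {j} j∈ = subst (fwd n a j ≤_) (fwd-antipode a) (∈-arc⁻ a (antipode n a) j∈)

  ∈-halfDisk⁺ : ∀ a {j} → fwd n a j ≤ n + 1 → j ∈ halfDisk a
  ∈-halfDisk⁺ a {j} le = ∈-arc⁺ a (antipode n a) (subst (fwd n a j ≤_) (sym (fwd-antipode a)) le)

  Leader : Fin d → Subset d → Set
  Leader a S = ∣ S ∣ ≡ 4 × a ∈ S × S ⊆ halfDisk a

  Leader? : ∀ a S → Dec (Leader a S)
  Leader? a S = (∣ S ∣ ≟ 4) ×-dec (a ∈? S) ×-dec (S ⊆? halfDisk a)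

  Leader⇒InQ₁ : ∀ {a S} → Leader a S → InQ₁ n S
  Leader⇒InQ₁ {a} (∣S∣≡4 , _ , S⊆) = ∣S∣≡4 , a , inj₁ S⊆

  InHalfDisk⇒bounded : ∀ i {S} → InHalfDisk n i S → ∃ λ j → ∀ {s} → s ∈ S → fwd n j s ≤ n + 1
  InHalfDisk⇒bounded i (inj₁ S⊆) = i , λ {s} s∈ →
    subst (fwd n i s ≤_) (fwd-antipode i) (∈-arc⁻ i (antipode n i) (S⊆ s∈))
  InHalfDisk⇒bounded i (inj₂ S⊆) = antipode n i , λ {s} s∈ →
    subst (fwd n (antipode n i) s ≤_) (fwd-antipode⁻¹ i) (∈-arc⁻ (antipode n i) i (S⊆ s∈))

  InQ₁⇒Leader : ∀ {S} → InQ₁ n S → ∃ λ a → Leader a S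
  InQ₁⇒Leader {S} (∣S∣≡4 , i , S-in) with InHalfDisk⇒bounded i S-in
  ... | j , bounded with argmin (fwd n j) S (∣p∣≡suc⇒Nonempty S ∣S∣≡4)
  ... | a , a∈S , a-first = a , ∣S∣≡4 , a∈S , λ {s} s∈ →
    ∈-halfDisk⁺ a (m+n≤o⇒m≤o (fwd n a s) (subst (_≤ n + 1) (sym (δ-trans j a s (a-first s∈))) (bounded s∈)))

  -- Going a → s → a is the whole circle while b → s → a is the arc b → a, so with
  -- both a → s and b → a at most half the circle the arc b → s must be empty.
  squeezed : ∀ {a} b {s} → s ≢ a → fwd n a s ≤ n + 1 → fwd n b a ≤ n + 1 → fwd n b s ≤ fwd n b a → s ≡ b
  squeezed {a} b {s} s≢a as≤ ba≤ bs≤ba = δ≡0⇒≡ (n≤0⇒n≡0 (+-cancelˡ-≤ d _ _ d+bs≤d+0))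
    where
    open ≤-Reasoning
    d+bs≤d+0 : d + fwd n b s ≤ d + 0
    d+bs≤d+0 = begin
      d + fwd n b s                          ≡⟨ cong (_+ fwd n b s) (δ-sym s≢a) ⟨
      fwd n a s + fwd n s a + fwd n b s      ≡⟨ +-assoc (fwd n a s) _ _ ⟩
      fwd n a s + (fwd n s a + fwd n b s)    ≡⟨ cong (fwd n a s +_) (δ-trans b s a bs≤ba) ⟩
      fwd n a s + fwd n b a                  ≤⟨ +-mono-≤ as≤ ba≤ ⟩
      n + 1 + (n + 1)                        ≡⟨ d≡[n+1]+[n+1] ⟨
      d                                      ≡⟨ +-identityʳ d ⟨
      d + 0                                  ∎

  Leader-unique : ∀ {a b S} → Leader a S → Leader b S → b ≡ a
  Leader-unique {a} {b} {S} (∣S∣≡4 , a∈S , S⊆a) (_ , b∈S , S⊆b) with b ≟ᶠ a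
  ... | yes b≡a = b≡a
  ... | no  b≢a = contradiction (subst (_≤ 2) ∣S∣≡4 ∣S∣≤2) λ { (s≤s (s≤s ())) }
    where
    ab≤ : fwd n a b ≤ n + 1
    ab≤ = ∈-halfDisk⁻ a (S⊆a b∈S)
    n+1≤ba : n + 1 ≤ fwd n b a
    n+1≤ba = +-cancelˡ-≤ (n + 1) _ _ (begin
      n + 1 + (n + 1)        ≡⟨ d≡[n+1]+[n+1] ⟨
      d                      ≡⟨ δ-sym b≢a ⟨
      fwd n a b + fwd n b a  ≤⟨ +-monoˡ-≤ (fwd n b a) ab≤ ⟩
      n + 1 + fwd n b a      ∎)
      where open ≤-Reasoning
    S⊆ab : S ⊆ ⁅ a ⁆ ∪ ⁅ b ⁆
    S⊆ab {s} s∈ with s ≟ᶠ a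
    ... | yes refl = x∈p∪q⁺ (inj₁ (x∈⁅x⁆ a))
    ... | no  s≢a  = subst (_∈ ⁅ a ⁆ ∪ ⁅ b ⁆) (sym s≡b) (x∈p∪q⁺ (inj₂ (x∈⁅x⁆ b)))
      where
      s≡b : s ≡ b
      s≡b = squeezed b s≢a (∈-halfDisk⁻ a (S⊆a s∈)) (∈-halfDisk⁻ b (S⊆b a∈S))
                           (≤-trans (∈-halfDisk⁻ b (S⊆b s∈)) n+1≤ba)
    ∣S∣≤2 : ∣ S ∣ ≤ 2
    ∣S∣≤2 = ≤-trans (p⊆q⇒∣p∣≤∣q∣ S⊆ab)
      (≤-trans (∣p∪q∣≤∣p∣+∣q∣ ⁅ a ⁆ ⁅ b ⁆) (≤-reflexive (cong₂ _+_ (∣⁅x⁆∣≡1 a) (∣⁅x⁆∣≡1 b))))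

  -- Slot of a vertex at forward distance k from a leader: the leader itself is forced,
  -- the n + 1 vertices following it are free, and the remaining n are excluded.
  slot : ℕ → Maybe Bool
  slot zero    = just true
  slot (suc t) = if t <ᵇ n + 1 then nothing else just false

  leaderPattern : Fin d → Pattern d
  leaderPattern a j = slot (fwd n a j)

  admits-slot⁺ : ∀ k b → (k ≡ 0 → T b) → (T b → k ≤ n + 1) → T (admits (slot k) b)
  admits-slot⁺ zero    b     at0 _     = at0 refl
  admits-slot⁺ (suc t) b     _   near  with t <ᵇ n + 1 in t<?
  ... | true  = _
  admits-slot⁺ (suc t) false _   _     | false = _
  admits-slot⁺ (suc t) true  _   near  | false = ⊥-elim (subst T t<? (<⇒<ᵇ (near _)))

  admits-slot⁻ : ∀ k b → T (admits (slot k) b) → (k ≡ 0 → T b) × (T b → k ≤ n + 1)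
  admits-slot⁻ zero    b    ok = (λ _ → ok) , (λ _ → z≤n)
  admits-slot⁻ (suc t) b    ok with t <ᵇ n + 1 in t<?
  ... | true  = (λ ()) , λ _ → <ᵇ⇒< t (n + 1) (subst T (sym t<?) _)
  admits-slot⁻ (suc t) false ok | false = (λ ()) , λ ()

  isFree-slot : ∀ t → isFree (slot (suc t)) ≡ 𝟙 (t <ᵇ n + 1)
  isFree-slot t with t <ᵇ n + 1
  ... | true  = refl
  ... | false = refl

  isForced-slot : ∀ t → isForced (slot (suc t)) ≡ 0
  isForced-slot t with t <ᵇ n + 1
  ... | true  = refl
  ... | false = refl

  free-leaderPattern : ∀ a → free (leaderPattern a) ≡ n + 1
  free-leaderPattern a = begin
    ∑[ j < d ] isFree (slot (fwd n a j))               ≡⟨ ∑-δ a (isFree ∘ slot) ⟩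
    ∑[ k < suc (2 * n) ] isFree (slot (suc (toℕ k)))   ≡⟨ sum-cong-≗ {n = suc (2 * n)} {x = isFree ∘ slot ∘ suc ∘ toℕ} (isFree-slot ∘ toℕ) ⟩
    ∑[ k < suc (2 * n) ] 𝟙 (toℕ k <ᵇ n + 1)           ≡⟨ ∑-𝟙-<ᵇ n+1≤1+2n ⟩
    n + 1                                              ∎
    where open ≡-Reasoning

  forced-leaderPattern : ∀ a → forced (leaderPattern a) ≡ 1
  forced-leaderPattern a = begin
    ∑[ j < d ] isForced (slot (fwd n a j))                 ≡⟨ ∑-δ a (isForced ∘ slot) ⟩
    1 + ∑[ k < suc (2 * n) ] isForced (slot (suc (toℕ k)))
      ≡⟨ cong suc (sum-cong-≗ {n = suc (2 * n)} {x = isForced ∘ slot ∘ suc ∘ toℕ} {y = λ _ → 0} (isForced-slot ∘ toℕ)) ⟩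
    1 + ∑[ k < suc (2 * n) ] 0                              ≡⟨ cong suc (sum-replicate-zero (suc (2 * n))) ⟩
    1                                                       ∎
    where open ≡-Reasoning

  fitsLeader : Fin d → Subset d → Bool
  fitsLeader a S = fits (leaderPattern a) S ∧ (freeMembers (leaderPattern a) S ≡ᵇ 3)

  Leader⇔fitsLeader : ∀ a S → Leader a S ⇔ T (fitsLeader a S)
  Leader⇔fitsLeader a S = mk⇔ to from
    where
    P = leaderPattern a
    to : Leader a S → T (fitsLeader a S)
    to (∣S∣≡4 , a∈S , S⊆) = Equivalence.from T-∧ (fits-P , ≡⇒≡ᵇ (freeMembers P S) 3 freeMembers≡3)
      where
      fits-P : T (fits P S)
      fits-P = admits⇒fits P S λ j → admits-slot⁺ (fwd n a j) (lookup S j)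
        (λ at0 → ∈⇒T-lookup (subst (_∈ S) (sym (δ≡0⇒≡ at0)) a∈S))
        (λ j∈ → ∈-halfDisk⁻ a (S⊆ (T-lookup⇒∈ j∈)))
      freeMembers≡3 : freeMembers P S ≡ 3
      freeMembers≡3 = +-cancelʳ-≡ 1 _ _ (begin
        freeMembers P S + 1          ≡⟨ cong (freeMembers P S +_) (forced-leaderPattern a) ⟨
        freeMembers P S + forced P   ≡⟨ ∣∣≡freeMembers+forced P S fits-P ⟨
        ∣ S ∣                        ≡⟨ ∣S∣≡4 ⟩
        3 + 1                        ∎)
        where open ≡-Reasoning
    from : T (fitsLeader a S) → Leader a S
    from ok = ∣S∣≡4 , a∈S , λ {s} s∈ → ∈-halfDisk⁺ a (proj₂ (admits-slot⁻ _ _ (admits-P s)) (∈⇒T-lookup s∈))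
      where
      fits-P : T (fits P S)
      fits-P = proj₁ (Equivalence.to T-∧ ok)
      admits-P : ∀ j → T (admits (P j) (lookup S j))
      admits-P = fits⇒admits P S fits-P
      a∈S : a ∈ S
      a∈S = T-lookup⇒∈ (proj₁ (admits-slot⁻ _ _ (admits-P a)) (δ-refl a))
      ∣S∣≡4 : ∣ S ∣ ≡ 4
      ∣S∣≡4 = trans (∣∣≡freeMembers+forced P S fits-P)
        (cong₂ _+_ (≡ᵇ⇒≡ (freeMembers P S) 3 (proj₂ (Equivalence.to T-∧ ok))) (forced-leaderPattern a))

  count-Leader : ∀ a → count (does ∘ Leader? a) L ≡ (n + 1) C 3
  count-Leader a = begin
    count (does ∘ Leader? a) L     ≡⟨ count-cong (λ S → does-⇔ (Leader⇔fitsLeader a S) (Leader? a S) (T? _)) L ⟩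
    count (fitsLeader a) L         ≡⟨ count-fits (leaderPattern a) 3 ⟩
    free (leaderPattern a) C 3     ≡⟨ cong (_C 3) (free-leaderPattern a) ⟩
    (n + 1) C 3                    ∎
    where open ≡-Reasoning

  𝟙-InQ₁≡∑-𝟙-Leader : ∀ S → 𝟙 (does (InQ₁? n S)) ≡ ∑[ a < d ] 𝟙 (does (Leader? a S))
  𝟙-InQ₁≡∑-𝟙-Leader S = by-cases (InQ₁? n S)
    where
    by-cases : (inQ₁? : Dec (InQ₁ n S)) → 𝟙 (does inQ₁?) ≡ ∑[ a < d ] 𝟙 (does (Leader? a S))
    by-cases (yes inQ₁) = sym (∑-𝟙-unique (λ a → Leader? a S) leads (Leader-unique leads))
      where leads = proj₂ (InQ₁⇒Leader inQ₁)
    by-cases (no ¬inQ₁) = sym (∑-𝟙-none (λ a → Leader? a S) (λ a → ¬inQ₁ ∘ Leader⇒InQ₁))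

  cardQ₁≡ : cardQ₁ n ≡ d * ((n + 1) C 3)
  cardQ₁≡ = begin
    length (filter (InQ₁? n) L)            ≡⟨ length-filter≡count (InQ₁? n) L ⟩
    count (does ∘ InQ₁? n) L               ≡⟨ count-∑ _ (λ a → does ∘ Leader? a) 𝟙-InQ₁≡∑-𝟙-Leader L ⟩
    ∑[ a < d ] count (does ∘ Leader? a) L  ≡⟨ sum-cong-≗ count-Leader ⟩
    ∑[ a < d ] ((n + 1) C 3)               ≡⟨ ∑-const d ((n + 1) C 3) ⟩
    d * ((n + 1) C 3)                      ∎
    where open ≡-Reasoning

corollary4p12 : (n : ℕ) → n ≥ 1 →
    2 * cardQ₁ n + (n + 1) C 2 ≡ (2 * n + 2) C 4
corollary4p12 n n≥1 = begin
  2 * cardQ₁ n + (n + 1) C 2                        ≡⟨ cong (λ c → 2 * c + (n + 1) C 2) (Polygon.cardQ₁≡ n) ⟩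
  2 * (N n * ((n + 1) C 3)) + (n + 1) C 2           ≡⟨ cong (λ m → 2 * (m * ((n + 1) C 3)) + (n + 1) C 2) (+-comm 2 (2 * n)) ⟩
  2 * ((2 * n + 2) * ((n + 1) C 3)) + (n + 1) C 2   ≡⟨ 2*[[2n+2]*[n+1]C3]+[n+1]C2≡[2n+2]C4 n≥1 ⟩
  (2 * n + 2) C 4                                   ∎
  where open ≡-Reasoning
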